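{- Let $n\ge a\ge 2$ be integers and let $G$ be a multigraph on $n$ vertices. If every set of $a+1$ vertices of $G$ induces at least one edge of multiplicity at least $2$, then $e(G)\ge\frac{2}{a}\binom{n}{2}-n$.
   Context: Here $e(G)$ denotes the number of edges of $G$ counted with multiplicity. -}

module Defs where

open import Data.Nat using (ℕ; zero; suc; _+_; _<?_)
open import Data.Fin using (Fin; zero; suc; toℕ)
open import Relation.Binary.PropositionalEquality using (_≡_)
open import Relation.Nullary using (yes; no)

record Multigraph (n : ℕ) : Set where
  field
    mult     : Fin n → Fin n → ℕ
    symmetric : ∀ i j → mult i j ≡ mult j i
    loopless  : ∀ i → mult i i ≡ 0
open Multigraph public

sumFin : ∀ {n} → (Fin n → ℕ) → ℕ
sumFin {zero}  f = 0
sumFin {suc n} f = f zero + sumFin (λ i → f (suc i))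

e : ∀ {n} → Multigraph n → ℕ
e {n} G = sumFin (λ i → sumFin (λ j → pick i j))
  where
  pick : Fin n → Fin n → ℕ
  pick i j with toℕ i <? toℕ j
  ... | yes _ = mult G i j
  ... | no  _ = 0

{-# OPTIONS --safe #-}
module Submission where

-- Call an edge heavy if its multiplicity is at least 2; the hypothesis says that
-- every independent set of the heavy graph has at most a vertices.  Given a vertex
-- set S, choose greedily a maximal such set I ⊆ S.  Each of the r vertices of S ∖ I
-- has a heavy edge into I, so the ordered edge count e[ S , S ] exceeds
-- e[ S ∖ I , S ∖ I ] by at least 4r, while ∣ I ∣ ≤ a.  Induction on ∣ S ∣ then gives
-- the Turán-type bound 2∣S∣² ≤ a e[ S , S ] + 2a∣S∣, which for S = V(G) reads
-- n² ≤ a e(G) + a n, and n² ≥ 2 (n C 2).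

open import Defs
open import Level using (0ℓ)
open import Function using (_∘_; id)
open import Data.Bool using (true; false; if_then_else_)
open import Data.Nat using (ℕ; zero; suc; _+_; _*_; _≤_; _<_; _<?_; _≤?_; z≤n)
open import Data.Nat.Properties
open import Data.Nat.Combinatorics using (_C_; nC1≡n; nCk+nC[k+1]≡[n+1]C[k+1])
open import Data.Nat.Induction using (<-wellFounded)
open import Data.Nat.Tactic.RingSolver using (solve-∀)
open import Algebra.Properties.Semiring.Sum +-*-semiring
  using (sum; sum-syntax; sum-cong-≗; sum-remove; ∑-distrib-+; ∑-comm; *-distribˡ-sum)
open import Data.Fin using (Fin; zero; suc; toℕ)
import Data.Fin.Properties as Fin
open import Data.Fin.Subset
  using (Subset; _∈_; _∉_; _⊆_; ∣_∣; _─_; _∪_; _∩_; ⁅_⁆; ⊤; ⊥; inside; outside; Nonempty)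
open import Data.Fin.Subset.Properties
  using ( _∈?_; ⊥⊆; ∉⊥; s⊆s; drop-∷-⊆; ∣⊥∣≡0; ∣⊤∣≡n; nonempty?; Empty-unique
        ; x∈⁅x⁆; x∈⁅y⁆⇒x≡y; p⊆p∪q; x∈p∪q⁺; x∈p∪q⁻; x∈p∩q⁺; p─q⊆p; p∩q≢∅⇒∣p─q∣<∣p∣)
open import Data.Vec using ([]; _∷_; lookup; here; there)
open import Data.Vec.Properties using (lookup-replicate; []=⇒lookup; lookup⇒[]=)
open import Data.List using (allFin) renaming ([] to []ᴸ; _∷_ to _∷ᴸ_)
open import Data.List.Membership.Propositional using () renaming (_∈_ to _∈ᴸ_)
open import Data.List.Membership.Propositional.Properties using (∈-allFin)
open import Data.List.Relation.Unary.Any using () renaming (here to hereᴸ; there to thereᴸ)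
open import Data.Product using (Σ; ∃-syntax; _×_; _,_; proj₁; proj₂)
open import Data.Sum using (_⊎_; inj₁; inj₂)
open import Induction.WellFounded using (module All)
open import Relation.Binary using (Rel; Decidable; Symmetric)
import Relation.Binary.Construct.On as On
open import Relation.Nullary using (yes; no; ¬_; _×-dec_; contradiction)
open import Relation.Binary.PropositionalEquality
  using (_≡_; _≢_; refl; sym; trans; cong; cong₂; subst; module ≡-Reasoning)

sumFin≡sum : ∀ {n} (f : Fin n → ℕ) → sumFin f ≡ sum f
sumFin≡sum {zero}  f = refl
sumFin≡sum {suc n} f = cong (f zero +_) (sumFin≡sum (f ∘ suc))

sum-mono-≤ : ∀ {n} {f g : Fin n → ℕ} → (∀ i → f i ≤ g i) → sum f ≤ sum g
sum-mono-≤ {zero}  f≤g = z≤n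
sum-mono-≤ {suc n} f≤g = +-mono-≤ (f≤g zero) (sum-mono-≤ (f≤g ∘ suc))

term≤sum : ∀ {n} (f : Fin n → ℕ) i → f i ≤ sum f
term≤sum {suc n} f i = ≤-trans (m≤m+n (f i) _) (≤-reflexive (sym (sum-remove f)))

χ : ∀ {n} → Subset n → Fin n → ℕ
χ p i = if lookup p i then 1 else 0

∣p∣≡∑χ : ∀ {n} (p : Subset n) → ∣ p ∣ ≡ ∑[ i < n ] χ p i
∣p∣≡∑χ []            = refl
∣p∣≡∑χ (inside ∷ p)  = cong suc (∣p∣≡∑χ p)
∣p∣≡∑χ (outside ∷ p) = ∣p∣≡∑χ p

χ-─ : ∀ {n} {p q : Subset n} → q ⊆ p → ∀ i → χ p i ≡ χ (p ─ q) i + χ q i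
χ-─ {p = inside  ∷ p} {inside  ∷ q} q⊆p zero    = refl
χ-─ {p = outside ∷ p} {inside  ∷ q} q⊆p zero    with () ← q⊆p here
χ-─ {p = inside  ∷ p} {outside ∷ q} q⊆p zero    = refl
χ-─ {p = outside ∷ p} {outside ∷ q} q⊆p zero    = refl
χ-─ {p = x ∷ p}       {inside  ∷ q} q⊆p (suc i) = χ-─ (drop-∷-⊆ q⊆p) i
χ-─ {p = x ∷ p}       {outside ∷ q} q⊆p (suc i) = χ-─ (drop-∷-⊆ q⊆p) i

∣p∣≡∣p─q∣+∣q∣ : ∀ {n} {p q : Subset n} → q ⊆ p → ∣ p ∣ ≡ ∣ p ─ q ∣ + ∣ q ∣
∣p∣≡∣p─q∣+∣q∣ {p = p} {q} q⊆p = begin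
  ∣ p ∣                                  ≡⟨ ∣p∣≡∑χ p ⟩
  sum (χ p)                              ≡⟨ sum-cong-≗ (χ-─ q⊆p) ⟩
  ∑[ i < _ ] (χ (p ─ q) i + χ q i)       ≡⟨ ∑-distrib-+ (χ (p ─ q)) (χ q) ⟩
  sum (χ (p ─ q)) + sum (χ q)            ≡⟨ cong₂ _+_ (∣p∣≡∑χ (p ─ q)) (∣p∣≡∑χ q) ⟨
  ∣ p ─ q ∣ + ∣ q ∣                      ∎
  where open ≡-Reasoning

x∈p─q⇒x∉q : ∀ {n} {x : Fin n} {p q : Subset n} → x ∈ p ─ q → x ∉ q
x∈p─q⇒x∉q {p = _ ∷ p} {outside ∷ q} (there x∈p─q) (there x∈q) = x∈p─q⇒x∉q x∈p─q x∈q
x∈p─q⇒x∉q {p = _ ∷ p} {inside  ∷ q} (there x∈p─q) (there x∈q) = x∈p─q⇒x∉q x∈p─q x∈q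
x∈p─q⇒x∉q {p = inside ∷ p} {outside ∷ q} here ()

subset-of-size : ∀ {n} k (p : Subset n) → k ≤ ∣ p ∣ → ∃[ q ] q ⊆ p × ∣ q ∣ ≡ k
subset-of-size {n} zero    p             _     = ⊥ , ⊥⊆ , ∣⊥∣≡0 n
subset-of-size (suc k) (outside ∷ p) k<∣p∣ with subset-of-size (suc k) p k<∣p∣
... | q , q⊆p , ∣q∣≡k = outside ∷ q , s⊆s q⊆p , ∣q∣≡k
subset-of-size (suc k) (inside ∷ p)  k<∣p∣ with subset-of-size k p (≤-pred k<∣p∣)
... | q , q⊆p , ∣q∣≡k = inside ∷ q , s⊆s q⊆p , cong suc ∣q∣≡k

module _ {n : ℕ} (R : Rel (Fin n) 0ℓ) where

  Independent : Subset n → Set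
  Independent I = ∀ {i j} → i ∈ I → j ∈ I → i ≢ j → ¬ R i j

  NeighbourIn : Subset n → Fin n → Set
  NeighbourIn I v = ∃[ j ] j ∈ I × R v j

  independent⇒∣∣≤ : ∀ {a I} →
    ((S : Subset n) → ∣ S ∣ ≡ suc a → ∃[ i ] ∃[ j ] (i ∈ S × j ∈ S × i ≢ j × R i j)) →
    Independent I → ∣ I ∣ ≤ a
  independent⇒∣∣≤ {a} {I} every-large-set-has-edge indI with a <? ∣ I ∣
  ... | no  a≮∣I∣ = ≮⇒≥ a≮∣I∣
  ... | yes a<∣I∣ with subset-of-size (suc a) I a<∣I∣
  ...   | S , S⊆I , ∣S∣≡1+a with every-large-set-has-edge S ∣S∣≡1+a
  ...     | i , j , i∈S , j∈S , i≢j , Rij = contradiction Rij (indI (S⊆I i∈S) (S⊆I j∈S) i≢j)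

module _ {n : ℕ} {R : Rel (Fin n) 0ℓ} (R? : Decidable R) (R-sym : Symmetric R) (S : Subset n) where

  private
    Dominated : Subset n → Fin n → Set
    Dominated I v = v ∈ I ⊎ NeighbourIn R I v

    dominated-mono : ∀ {I J v} → I ⊆ J → Dominated I v → Dominated J v
    dominated-mono I⊆J (inj₁ v∈I)             = inj₁ (I⊆J v∈I)
    dominated-mono I⊆J (inj₂ (j , j∈I , Rvj)) = inj₂ (j , I⊆J j∈I , Rvj)

    IndependentSubset : Subset n → Set
    IndependentSubset I = I ⊆ S × Independent R I

    independent-∪⁅⁆ : ∀ {I v} → Independent R I → ¬ NeighbourIn R I v → Independent R (I ∪ ⁅ v ⁆)
    independent-∪⁅⁆ {I} {v} indI no-nb {i} {j} i∈ j∈ i≢j with x∈p∪q⁻ I ⁅ v ⁆ i∈ | x∈p∪q⁻ I ⁅ v ⁆ j∈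
    ... | inj₁ i∈I | inj₁ j∈I = indI i∈I j∈I i≢j
    ... | inj₁ i∈I | inj₂ j∈v rewrite x∈⁅y⁆⇒x≡y v j∈v = λ Riv → no-nb (i , i∈I , R-sym Riv)
    ... | inj₂ i∈v | inj₁ j∈I rewrite x∈⁅y⁆⇒x≡y v i∈v = λ Rvj → no-nb (j , j∈I , Rvj)
    ... | inj₂ i∈v | inj₂ j∈v = contradiction (trans (x∈⁅y⁆⇒x≡y v i∈v) (sym (x∈⁅y⁆⇒x≡y v j∈v))) i≢j

    visit : ∀ v I → IndependentSubset I → ∃[ J ] I ⊆ J × IndependentSubset J × (v ∈ S → Dominated J v)
    visit v I (I⊆S , indI) with v ∈? S | Fin.any? (λ j → j ∈? I ×-dec R? v j)
    ... | no v∉S  | _      = I , id , (I⊆S , indI) , λ v∈S → contradiction v∈S v∉S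
    ... | yes _   | yes nb = I , id , (I⊆S , indI) , λ _ → inj₂ nb
    ... | yes v∈S | no ¬nb = I ∪ ⁅ v ⁆ , p⊆p∪q ⁅ v ⁆ , (I∪v⊆S , independent-∪⁅⁆ indI ¬nb) ,
                             λ _ → inj₁ (x∈p∪q⁺ (inj₂ (x∈⁅x⁆ v)))
      where
      I∪v⊆S : I ∪ ⁅ v ⁆ ⊆ S
      I∪v⊆S x∈ with x∈p∪q⁻ I ⁅ v ⁆ x∈
      ... | inj₁ x∈I = I⊆S x∈I
      ... | inj₂ x∈v rewrite x∈⁅y⁆⇒x≡y v x∈v = v∈S

    visitAll : ∀ vs I → IndependentSubset I →
      ∃[ J ] I ⊆ J × IndependentSubset J × (∀ {v} → v ∈ᴸ vs → v ∈ S → Dominated J v)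
    visitAll []ᴸ       I indep = I , id , indep , λ ()
    visitAll (v ∷ᴸ vs) I indep with visit v I indep
    ... | I′ , I⊆I′ , indep′ , v-dom with visitAll vs I′ indep′
    ...   | J , I′⊆J , indepJ , vs-dom = J , I′⊆J ∘ I⊆I′ , indepJ , dom
      where
      dom : ∀ {w} → w ∈ᴸ v ∷ᴸ vs → w ∈ S → Dominated J w
      dom (hereᴸ refl)  = dominated-mono I′⊆J ∘ v-dom
      dom (thereᴸ w∈vs) = vs-dom w∈vs

  maximal-independent : ∃[ I ] I ⊆ S × Independent R I × (∀ {v} → v ∈ S → v ∉ I → NeighbourIn R I v)
  maximal-independent with visitAll (allFin n) ⊥ (⊥⊆ , λ i∈⊥ → contradiction i∈⊥ ∉⊥)
  ... | I , _ , (I⊆S , indI) , dom = I , I⊆S , indI , neighbour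
    where
    neighbour : ∀ {v} → v ∈ S → v ∉ I → NeighbourIn R I v
    neighbour {v} v∈S v∉I with dom (∈-allFin v) v∈S
    ... | inj₁ v∈I = contradiction v∈I v∉I
    ... | inj₂ nb  = nb

square-bound-step : ∀ a r t D′ D → 2 * (r * r) ≤ a * D′ + 2 * (a * r) → t ≤ a → D′ + 4 * r ≤ D →
  2 * ((r + t) * (r + t)) ≤ a * D + 2 * (a * (r + t))
square-bound-step a r t D′ D ih t≤a D′+4r≤D = begin
  2 * ((r + t) * (r + t))                         ≡⟨ expand r t ⟩
  2 * (r * r) + (4 * (t * r) + 2 * (t * t))
    ≤⟨ +-mono-≤ ih (+-mono-≤ (*-monoʳ-≤ 4 (*-monoˡ-≤ r t≤a)) (*-monoʳ-≤ 2 (*-monoˡ-≤ t t≤a))) ⟩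
  a * D′ + 2 * (a * r) + (4 * (a * r) + 2 * (a * t)) ≡⟨ regroup a D′ r t ⟩
  a * (D′ + 4 * r) + 2 * (a * (r + t))            ≤⟨ +-monoˡ-≤ (2 * (a * (r + t))) (*-monoʳ-≤ a D′+4r≤D) ⟩
  a * D + 2 * (a * (r + t))                       ∎
  where
  open ≤-Reasoning
  expand : ∀ r t → 2 * ((r + t) * (r + t)) ≡ 2 * (r * r) + (4 * (t * r) + 2 * (t * t))
  expand = solve-∀
  regroup : ∀ a D′ r t →
    a * D′ + 2 * (a * r) + (4 * (a * r) + 2 * (a * t)) ≡ a * (D′ + 4 * r) + 2 * (a * (r + t))
  regroup = solve-∀

-- The summand of e is local to the definition of e; this names it by letting
-- Agda read it off the normal form of e G.
upperTriangle : ∀ {n} (G : Multigraph n) → Σ (Fin n → Fin n → ℕ) λ U → e G ≡ sumFin (λ i → sumFin (U i))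
upperTriangle G = _ , refl

module _ {n : ℕ} (G : Multigraph n) where

  Heavy : Rel (Fin n) 0ℓ
  Heavy i j = 2 ≤ mult G i j

  heavy? : Decidable Heavy
  heavy? i j = 2 ≤? mult G i j

  heavy-sym : Symmetric Heavy
  heavy-sym {i} {j} = subst (2 ≤_) (symmetric G i j)

  -- Ordered pairs, so e[ S , S ] is twice the number of edges inside S.
  e[_,_] : Subset n → Subset n → ℕ
  e[ P , Q ] = ∑[ i < n ] (∑[ j < n ] (χ P i * χ Q j * mult G i j))

  private
    U : Fin n → Fin n → ℕ
    U = proj₁ (upperTriangle G)

    mult≡U+Uᵀ : ∀ i j → mult G i j ≡ U i j + U j i
    mult≡U+Uᵀ i j with toℕ i <? toℕ j | toℕ j <? toℕ i
    ... | yes i<j | yes j<i = contradiction j<i (<-asym i<j)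
    ... | yes _   | no _    = sym (+-identityʳ _)
    ... | no _    | yes _   = symmetric G i j
    ... | no i≮j  | no j≮i rewrite Fin.toℕ-injective (≤-antisym (≮⇒≥ j≮i) (≮⇒≥ i≮j)) = loopless G j

  e[⊤,⊤]≡2e : e[ ⊤ , ⊤ ] ≡ 2 * e G
  e[⊤,⊤]≡2e = begin
    e[ ⊤ , ⊤ ]                                       ≡⟨ sum-cong-≗ (λ i → sum-cong-≗ (χ⊤χ⊤M≡M i)) ⟩
    ∑[ i < n ] (∑[ j < n ] mult G i j)              ≡⟨ sum-cong-≗ (λ i → sum-cong-≗ (mult≡U+Uᵀ i)) ⟩
    ∑[ i < n ] (∑[ j < n ] (U i j + U j i))         ≡⟨ sum-cong-≗ (λ i → ∑-distrib-+ (U i) (λ j → U j i)) ⟩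
    ∑[ i < n ] (sum (U i) + ∑[ j < n ] U j i)       ≡⟨ ∑-distrib-+ (sum ∘ U) (λ i → ∑[ j < n ] U j i) ⟩
    sum (sum ∘ U) + ∑[ i < n ] (∑[ j < n ] U j i)    ≡⟨ cong (sum (sum ∘ U) +_) (∑-comm (λ i j → U j i)) ⟩
    sum (sum ∘ U) + sum (sum ∘ U)                    ≡⟨ cong (λ x → x + x) e≡∑∑U ⟨
    e G + e G                                        ≡⟨ cong (e G +_) (+-identityʳ (e G)) ⟨
    2 * e G                                          ∎
    where
    open ≡-Reasoning
    χ⊤χ⊤M≡M : ∀ i j → χ ⊤ i * χ ⊤ j * mult G i j ≡ mult G i j
    χ⊤χ⊤M≡M i j rewrite lookup-replicate i inside | lookup-replicate j inside = +-identityʳ _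
    e≡∑∑U : e G ≡ sum (sum ∘ U)
    e≡∑∑U = trans (proj₂ (upperTriangle G))
              (trans (sumFin≡sum (sumFin ∘ U)) (sum-cong-≗ (λ i → sumFin≡sum (U i))))

  e[,]-comm : ∀ P Q → e[ P , Q ] ≡ e[ Q , P ]
  e[,]-comm P Q = trans (∑-comm (λ i j → χ P i * χ Q j * mult G i j)) (sum-cong-≗ λ j → sum-cong-≗ λ i →
    cong₂ _*_ (*-comm (χ P i) (χ Q j)) (symmetric G i j))

  e[,]-distribʳ : ∀ S P Q → (∀ i → χ S i ≡ χ P i + χ Q i) → ∀ R → e[ S , R ] ≡ e[ P , R ] + e[ Q , R ]
  e[,]-distribʳ S P Q χS≡χP+χQ R = begin
    e[ S , R ]                                         ≡⟨ sum-cong-≗ (λ i → sum-cong-≗ (split i)) ⟩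
    ∑[ i < n ] (∑[ j < n ] (w P i j + w Q i j))        ≡⟨ sum-cong-≗ (λ i → ∑-distrib-+ (w P i) (w Q i)) ⟩
    ∑[ i < n ] (sum (w P i) + sum (w Q i))             ≡⟨ ∑-distrib-+ (sum ∘ w P) (sum ∘ w Q) ⟩
    e[ P , R ] + e[ Q , R ]                            ∎
    where
    open ≡-Reasoning
    w : Subset n → Fin n → Fin n → ℕ
    w X i j = χ X i * χ R j * mult G i j
    distrib : ∀ p q r m → (p + q) * r * m ≡ p * r * m + q * r * m
    distrib = solve-∀
    split : ∀ i j → w S i j ≡ w P i j + w Q i j
    split i j = trans (cong (λ x → x * χ R j * mult G i j) (χS≡χP+χQ i))
                      (distrib (χ P i) (χ Q i) (χ R j) (mult G i j))

  e[,]-partition : ∀ S P Q → (∀ i → χ S i ≡ χ P i + χ Q i) →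
    e[ S , S ] ≡ e[ P , P ] + e[ P , Q ] + e[ Q , P ] + e[ Q , Q ]
  e[,]-partition S P Q χS≡χP+χQ = begin
    e[ S , S ]                                          ≡⟨ e[,]-distribʳ S P Q χS≡χP+χQ S ⟩
    e[ P , S ] + e[ Q , S ]                             ≡⟨ cong₂ _+_ (distribˡ P) (distribˡ Q) ⟩
    e[ P , P ] + e[ P , Q ] + (e[ Q , P ] + e[ Q , Q ]) ≡⟨ +-assoc (e[ P , P ] + e[ P , Q ]) _ _ ⟨
    e[ P , P ] + e[ P , Q ] + e[ Q , P ] + e[ Q , Q ]   ∎
    where
    open ≡-Reasoning
    distribˡ : ∀ R → e[ R , S ] ≡ e[ R , P ] + e[ R , Q ]
    distribˡ R = begin
      e[ R , S ]               ≡⟨ e[,]-comm R S ⟩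
      e[ S , R ]               ≡⟨ e[,]-distribʳ S P Q χS≡χP+χQ R ⟩
      e[ P , R ] + e[ Q , R ]  ≡⟨ cong₂ _+_ (e[,]-comm P R) (e[,]-comm Q R) ⟩
      e[ R , P ] + e[ R , Q ]  ∎

  2∣P∣≤e[P,Q] : ∀ {P Q} → (∀ {v} → v ∈ P → NeighbourIn Heavy Q v) → 2 * ∣ P ∣ ≤ e[ P , Q ]
  2∣P∣≤e[P,Q] {P} {Q} heavy-neighbour = begin
    2 * ∣ P ∣                               ≡⟨ cong (2 *_) (∣p∣≡∑χ P) ⟩
    2 * sum (χ P)                           ≡⟨ *-distribˡ-sum 2 (χ P) ⟩
    ∑[ i < n ] (2 * χ P i)                  ≤⟨ sum-mono-≤ row≥2 ⟩
    e[ P , Q ]                              ∎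
    where
    open ≤-Reasoning
    row≥2 : ∀ i → 2 * χ P i ≤ ∑[ j < n ] (χ P i * χ Q j * mult G i j)
    row≥2 i with lookup P i in Pᵢ
    ... | false = z≤n
    ... | true with heavy-neighbour (lookup⇒[]= i P Pᵢ)
    ...   | j , j∈Q , heavy = ≤-trans heavy (≤-trans (≤-reflexive eq) (term≤sum _ j))
      where
      eq : mult G i j ≡ 1 * χ Q j * mult G i j
      eq rewrite []=⇒lookup j∈Q = sym (+-identityʳ _)

  TuránBound : ℕ → Subset n → Set
  TuránBound a S = 2 * (∣ S ∣ * ∣ S ∣) ≤ a * e[ S , S ] + 2 * (a * ∣ S ∣)

  turán-bound : ∀ a → (∀ {I} → Independent Heavy I → ∣ I ∣ ≤ a) → ∀ S → TuránBound a S
  turán-bound a α≤a = All.wfRec (On.wellFounded ∣_∣ <-wellFounded) 0ℓ (TuránBound a) step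
    where
    step : ∀ S → (∀ {T} → ∣ T ∣ < ∣ S ∣ → TuránBound a T) → TuránBound a S
    step S rec with nonempty? S | maximal-independent heavy? heavy-sym S
    ... | no S-empty | _ rewrite Empty-unique S-empty | ∣⊥∣≡0 n = z≤n
    ... | yes (v , v∈S) | I , I⊆S , indI , neighbour =
      subst (λ m → 2 * (m * m) ≤ a * e[ S , S ] + 2 * (a * m)) (sym (∣p∣≡∣p─q∣+∣q∣ I⊆S))
        (square-bound-step a r ∣ I ∣ e[ S′ , S′ ] e[ S , S ] (rec {S′} S′<S) (α≤a indI) growth)
      where
      S′ = S ─ I
      r = ∣ S′ ∣

      S∩I-nonempty : Nonempty (S ∩ I)
      S∩I-nonempty with v ∈? I
      ... | yes v∈I = v , x∈p∩q⁺ (v∈S , v∈I)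
      ... | no  v∉I with neighbour v∈S v∉I
      ...   | j , j∈I , _ = j , x∈p∩q⁺ (I⊆S j∈I , j∈I)

      S′<S : ∣ S′ ∣ < ∣ S ∣
      S′<S = p∩q≢∅⇒∣p─q∣<∣p∣ S I S∩I-nonempty

      cross : 2 * r ≤ e[ S′ , I ]
      cross = 2∣P∣≤e[P,Q] (λ v∈S′ → neighbour (p─q⊆p S I v∈S′) (x∈p─q⇒x∉q v∈S′))

      growth : e[ S′ , S′ ] + 4 * r ≤ e[ S , S ]
      growth = begin
        e[ S′ , S′ ] + 4 * r                                    ≡⟨ split-4 e[ S′ , S′ ] r ⟩
        e[ S′ , S′ ] + 2 * r + 2 * r                            ≤⟨ +-mono-≤ (+-monoʳ-≤ e[ S′ , S′ ] cross) cross′ ⟩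
        e[ S′ , S′ ] + e[ S′ , I ] + e[ I , S′ ]                ≤⟨ m≤m+n _ e[ I , I ] ⟩
        e[ S′ , S′ ] + e[ S′ , I ] + e[ I , S′ ] + e[ I , I ]   ≡⟨ e[,]-partition S S′ I (χ-─ I⊆S) ⟨
        e[ S , S ]                                              ∎
        where
        open ≤-Reasoning
        split-4 : ∀ x r → x + 4 * r ≡ x + 2 * r + 2 * r
        split-4 = solve-∀
        cross′ : 2 * r ≤ e[ I , S′ ]
        cross′ = ≤-trans cross (≤-reflexive (e[,]-comm S′ I))

  turán : ∀ a → (∀ {I} → Independent Heavy I → ∣ I ∣ ≤ a) → n * n ≤ a * e G + a * n
  turán a α≤a = *-cancelˡ-≤ 2 (begin
    2 * (n * n)                              ≡⟨ cong (λ m → 2 * (m * m)) (∣⊤∣≡n n) ⟨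
    2 * (∣ ⊤ {n} ∣ * ∣ ⊤ {n} ∣)              ≤⟨ turán-bound a α≤a ⊤ ⟩
    a * e[ ⊤ , ⊤ ] + 2 * (a * ∣ ⊤ {n} ∣)     ≡⟨ cong₂ (λ x m → a * x + 2 * (a * m)) e[⊤,⊤]≡2e (∣⊤∣≡n n) ⟩
    a * (2 * e G) + 2 * (a * n)              ≡⟨ factor-2 a (e G) n ⟩
    2 * (a * e G + a * n)                    ∎)
    where
    open ≤-Reasoning
    factor-2 : ∀ a x n → a * (2 * x) + 2 * (a * n) ≡ 2 * (a * x + a * n)
    factor-2 = solve-∀

2[nC2]+n≡n*n : ∀ n → 2 * (n C 2) + n ≡ n * n
2[nC2]+n≡n*n zero    = refl
2[nC2]+n≡n*n (suc n) = begin
  2 * (suc n C 2) + suc n          ≡⟨ cong (λ c → 2 * c + suc n) (nCk+nC[k+1]≡[n+1]C[k+1] n 1) ⟨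
  2 * (n C 1 + n C 2) + suc n      ≡⟨ cong (λ c → 2 * (c + n C 2) + suc n) (nC1≡n n) ⟩
  2 * (n + n C 2) + suc n          ≡⟨ regroup n (n C 2) ⟩
  2 * (n C 2) + n + (2 * n + 1)    ≡⟨ cong (_+ (2 * n + 1)) (2[nC2]+n≡n*n n) ⟩
  n * n + (2 * n + 1)              ≡⟨ square-suc n ⟩
  suc n * suc n                    ∎
  where
  open ≡-Reasoning
  regroup : ∀ n c → 2 * (n + c) + suc n ≡ 2 * c + n + (2 * n + 1)
  regroup = solve-∀
  square-suc : ∀ n → n * n + (2 * n + 1) ≡ suc n * suc n
  square-suc = solve-∀

lemma3p16 : (n a : ℕ) → 2 ≤ a → a ≤ n → (G : Multigraph n) →
    ((S : Subset n) → ∣ S ∣ ≡ suc a →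
      ∃[ i ] ∃[ j ] (i ∈ S × j ∈ S × i ≢ j × 2 ≤ mult G i j)) →
    2 * (n C 2) ≤ a * e G + a * n
lemma3p16 n a _ _ G every-large-set-has-heavy-edge = begin
  2 * (n C 2)        ≤⟨ m≤m+n (2 * (n C 2)) n ⟩
  2 * (n C 2) + n    ≡⟨ 2[nC2]+n≡n*n n ⟩
  n * n              ≤⟨ turán G a (independent⇒∣∣≤ (Heavy G) every-large-set-has-heavy-edge) ⟩
  a * e G + a * n    ∎
  where open ≤-Reasoning
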